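{- For every integer $n\ge 3$, the gear graph $G_n$ is neighborhood-prime.
   Context: A neighborhood-prime labeling of a simple graph $G$ with $N$ vertices is a bijection $f:V(G)\to\{1,2,\ldots,N\}$ such that for every vertex $v$ with $\deg(v)>1$, $\gcd\{f(u):u\in N(v)\}=1$, where $N(v)$ is the set of vertices adjacent to $v$. A graph admitting such a labeling is called neighborhood-prime. The gear graph $G_n$ is obtained from the wheel $W_n=C_n+K_1$ (a cycle on $n$ vertices together with a center vertex adjacent to all cycle vertices) by inserting a new vertex on each edge of the cycle $C_n$ (i.e., subdividing each cycle edge once). -}

module Defs where

open import Data.Nat using (ℕ; zero; suc; _+_; _*_; _<_; _∸_; _≡ᵇ_; _<ᵇ_)
open import Data.Nat.GCD using (gcd)
open import Data.Bool using (Bool; true; false; _∧_; _∨_; not; T)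
open import Data.Fin using (Fin; toℕ)
open import Data.List using (List; foldr; map; filter; length)
open import Data.List.Base using (filterᵇ)
open import Data.Fin.Base using ()
open import Data.List using (allFin)
open import Function.Bundles using (Bijection)
open import Function using (_∘_)
open import Relation.Binary.PropositionalEquality using (_≡_; refl; cong; cong₂; setoid)
open import Data.Bool.Properties using (∨-comm)
open import Data.Product using (Σ)

record SimpleGraph (N : ℕ) : Set where
  field
    adj   : Fin N → Fin N → Bool
    sym   : ∀ u v → adj u v ≡ adj v u
    irrefl : ∀ v → adj v v ≡ false

open SimpleGraph public

nbhd : ∀ {N} → SimpleGraph N → Fin N → List (Fin N)
nbhd G v = filterᵇ (adj G v) (allFin _)

deg : ∀ {N} → SimpleGraph N → Fin N → ℕ
deg G v = length (nbhd G v)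

gcdList : List ℕ → ℕ
gcdList = foldr gcd 0

-- A labeling is a bijection V(G) = Fin N → {1,…,N}; we represent {1,…,N}
-- as Fin N, with the label of v being  toℕ (f v) + 1.
Labeling : ℕ → Set
Labeling N = Bijection (setoid (Fin N)) (setoid (Fin N))

label : ∀ {N} → Labeling N → Fin N → ℕ
label f v = suc (toℕ (Bijection.to f v))

IsNeighborhoodPrimeLabeling : ∀ {N} → SimpleGraph N → Labeling N → Set
IsNeighborhoodPrimeLabeling G f =
  ∀ v → 1 < deg G v → gcdList (map (label f) (nbhd G v)) ≡ 1

NeighborhoodPrime : ∀ {N} → SimpleGraph N → Set
NeighborhoodPrime {N} G = Σ (Labeling N) (IsNeighborhoodPrimeLabeling G)

-- The gear graph G_n, on 2n+1 vertices, numbered as follows: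
--   0            : the centre c
--   1 + i        : rim (original cycle) vertex r_i,        0 ≤ i < n
--   1 + n + i    : subdivision vertex s_i on edge r_i r_{i+1 mod n}
-- Edges: c – r_i,  r_i – s_i,  s_i – r_{(i+1) mod n}.

gearArc : ℕ → ℕ → ℕ → Bool
gearArc n a b =
     ((a ≡ᵇ 0) ∧ ((0 <ᵇ b) ∧ (b <ᵇ suc n)))                        -- c – r_i
  ∨ (((0 <ᵇ a) ∧ (a <ᵇ suc n)) ∧ (b ≡ᵇ a + n))                     -- r_i – s_i
  ∨ (((n <ᵇ b) ∧ (b <ᵇ n + n)) ∧ (a ≡ᵇ suc (b ∸ n)))               -- s_i – r_(i+1), i+1 < n
  ∨ ((b ≡ᵇ n + n) ∧ (a ≡ᵇ 1))                                      -- s_(n-1) – r_0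

gearAdjℕ : ℕ → ℕ → ℕ → Bool
gearAdjℕ n a b = gearArc n a b ∨ gearArc n b a

≡ᵇ-sym : ∀ a b → (a ≡ᵇ b) ≡ (b ≡ᵇ a)
≡ᵇ-sym zero    zero    = refl
≡ᵇ-sym zero    (suc b) = refl
≡ᵇ-sym (suc a) zero    = refl
≡ᵇ-sym (suc a) (suc b) = ≡ᵇ-sym a b

≡ᵇ-refl : ∀ a → (a ≡ᵇ a) ≡ true
≡ᵇ-refl zero    = refl
≡ᵇ-refl (suc a) = ≡ᵇ-refl a

-- adjacency of the gear graph; the guard  not (a ≡ᵇ b)  only serves to make
-- irreflexivity definitionally evident (for n ≥ 2 there are no loops anyway).
gearAdjSafe : ℕ → ℕ → ℕ → Bool
gearAdjSafe n a b = not (a ≡ᵇ b) ∧ gearAdjℕ n a b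

gear : (n : ℕ) → SimpleGraph (suc (n + n))
gear n = record
  { adj    = λ u v → gearAdjSafe n (toℕ u) (toℕ v)
  ; sym    = λ u v → cong₂ _∧_ (cong not (≡ᵇ-sym (toℕ u) (toℕ v)))
                               (∨-comm (gearArc n (toℕ u) (toℕ v)) (gearArc n (toℕ v) (toℕ u)))
  ; irrefl = λ v → cong (λ x → not x ∧ gearAdjℕ n (toℕ v) (toℕ v)) (≡ᵇ-refl (toℕ v))
  }

-- Label the centre 2n + 1 and every other vertex by its position in the
-- order r₀, …, r_{n-1}, s₀, …, s_{n-1}. Then every vertex has a neighbour
-- labelled 1 or two neighbours with consecutive labels, either of which
-- forces the gcd of its neighbourhood to be 1: the centre sees r₀, each
-- sᵢ sees rᵢ and rᵢ₊₁ (and s_{n-1} sees r₀), each rᵢ with i ≥ 1 sees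
-- sᵢ₋₁ and sᵢ, and r₀ sees s_{n-1} and the centre, labelled 2n and 2n + 1.
module Submission where

open import Defs hiding (sym)
open import Data.Bool using (Bool; T; _∧_; not)
open import Data.Bool.Properties using (T-≡; T-∧; T-∨; T-not-≡; ¬-not)
open import Data.Fin using (Fin; zero; suc; toℕ; fromℕ; fromℕ<; punchIn)
open import Data.Fin.Permutation using (insert; id)
open import Data.Fin.Properties using (toℕ-fromℕ; toℕ-fromℕ<; toℕ<n)
open import Data.List using (List; _∷_; map)
open import Data.List.Membership.Propositional using (_∈_)
open import Data.List.Membership.Propositional.Properties using (∈-map⁺; ∈-filter⁺; ∈-allFin)
open import Data.List.Relation.Unary.Any using (here; there)
open import Data.Nat using (ℕ; zero; suc; _+_; _∸_; _≤_; _<_; _≡ᵇ_; _<ᵇ_; _<?_; z≤n; s≤s; z<s)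
open import Data.Nat.Divisibility using (_∣_; ∣-trans; ∣1⇒≡1; ∣m+n∣m⇒∣n)
open import Data.Nat.GCD using (gcd[m,n]∣m; gcd[m,n]∣n)
open import Data.Nat.Properties
open import Data.Product using (_,_)
open import Data.Sum using (_⊎_; inj₁; inj₂; [_,_]) renaming (map to ⊎-map)
open import Function using (_∘_)
open import Function.Bundles using (Equivalence)
open import Function.Properties.Inverse using (Inverse⇒Bijection)
open import Relation.Binary.PropositionalEquality using (_≡_; _≢_; refl; sym; trans; cong; subst; module ≡-Reasoning)
open import Relation.Nullary using (yes; no)
open import Relation.Nullary.Decidable using (T?)

open Equivalence using (from)

gcdList-∣ : ∀ {x xs} → x ∈ xs → gcdList xs ∣ x
gcdList-∣ {xs = y ∷ ys} (here refl)  = gcd[m,n]∣m y (gcdList ys)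
gcdList-∣ {xs = y ∷ ys} (there x∈ys) = ∣-trans (gcd[m,n]∣n y (gcdList ys)) (gcdList-∣ x∈ys)

1∈⇒gcdList≡1 : ∀ {xs} → 1 ∈ xs → gcdList xs ≡ 1
1∈⇒gcdList≡1 1∈xs = ∣1⇒≡1 (gcdList-∣ 1∈xs)

consecutive∈⇒gcdList≡1 : ∀ {a xs} → a ∈ xs → suc a ∈ xs → gcdList xs ≡ 1
consecutive∈⇒gcdList≡1 {a} {xs} a∈xs 1+a∈xs =
  ∣1⇒≡1 (∣m+n∣m⇒∣n (subst (gcdList xs ∣_) (+-comm 1 a) (gcdList-∣ 1+a∈xs)) (gcdList-∣ a∈xs))

module _ {N} (G : SimpleGraph N) (f : Labeling N) where

  neighbourLabels : Fin N → List ℕ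
  neighbourLabels v = map (label f) (nbhd G v)

  adj⇒label∈neighbourLabels : ∀ {v u} → T (adj G v u) → label f u ∈ neighbourLabels v
  adj⇒label∈neighbourLabels {v} {u} vu = ∈-map⁺ (label f) (∈-filter⁺ (T? ∘ adj G v) (∈-allFin u) vu)

  data CoprimeNeighbours (v : Fin N) : Set where
    neighbour-labelled-1 : ∀ {u} → T (adj G v u) → label f u ≡ 1 → CoprimeNeighbours v
    consecutive-neighbours : ∀ {u w} → T (adj G v u) → T (adj G v w) →
                             label f w ≡ suc (label f u) → CoprimeNeighbours v

  coprimeNeighbours⇒gcd≡1 : ∀ {v} → CoprimeNeighbours v → gcdList (neighbourLabels v) ≡ 1
  coprimeNeighbours⇒gcd≡1 {v} (neighbour-labelled-1 vu u↦1) =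
    1∈⇒gcdList≡1 (subst (_∈ neighbourLabels v) u↦1 (adj⇒label∈neighbourLabels vu))
  coprimeNeighbours⇒gcd≡1 {v} (consecutive-neighbours vu vw w↦1+u) =
    consecutive∈⇒gcdList≡1 (adj⇒label∈neighbourLabels vu)
      (subst (_∈ neighbourLabels v) w↦1+u (adj⇒label∈neighbourLabels vw))

toℕ-punchIn-fromℕ : ∀ {N} (j : Fin N) → toℕ (punchIn (fromℕ N) j) ≡ toℕ j
toℕ-punchIn-fromℕ zero    = refl
toℕ-punchIn-fromℕ (suc j) = cong suc (toℕ-punchIn-fromℕ j)

zeroToLast : ∀ N → Labeling (suc N)
zeroToLast N = Inverse⇒Bijection (insert zero (fromℕ N) id)

zeroToLastℕ : ℕ → ℕ → ℕ
zeroToLastℕ N zero    = suc N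
zeroToLastℕ N (suc k) = suc k

label-zeroToLast : ∀ {N} (v : Fin (suc N)) → label (zeroToLast N) v ≡ zeroToLastℕ N (toℕ v)
label-zeroToLast {N} zero = cong suc (toℕ-fromℕ N)
label-zeroToLast (suc j)  = cong suc (toℕ-punchIn-fromℕ j)

data GearEdge (n : ℕ) : ℕ → ℕ → Set where
  centre–rim       : ∀ {i} → i < n → GearEdge n 0 (suc i)
  rim–sub          : ∀ {i} → i < n → GearEdge n (suc i) (suc i + n)
  sub–nextRim      : ∀ {i} → suc i < n → GearEdge n (suc (suc i)) (suc i + n)
  lastSub–firstRim : ∀ {i} → suc i ≡ n → GearEdge n 1 (suc i + n)

GearEdge⇒< : ∀ {n a b} → GearEdge n a b → a < b
GearEdge⇒< (centre–rim _)              = z<s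
GearEdge⇒< (rim–sub {i} i<n)           = m<m+n (suc i) (≤-trans z<s i<n)
GearEdge⇒< (sub–nextRim {i} 1+i<n)     = s≤s (≤-trans 1+i<n (m≤n+m _ i))
GearEdge⇒< (lastSub–firstRim {i} refl) = s≤s (≤-trans z<s (m≤n+m (suc i) i))

GearEdge⇒≤ : ∀ {n a b} → GearEdge n a b → b ≤ n + n
GearEdge⇒≤ {n} (centre–rim i<n)    = ≤-trans i<n (m≤m+n n n)
GearEdge⇒≤ {n} (rim–sub i<n)       = +-monoˡ-≤ n i<n
GearEdge⇒≤ {n} (sub–nextRim 1+i<n) = +-monoˡ-≤ n (<⇒≤ 1+i<n)
GearEdge⇒≤ (lastSub–firstRim refl) = ≤-refl

-- The middle two clauses of gearArc, spelled out so that a proof of a later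
-- clause can step past them.
rimSubClause subNextRimClause : ℕ → ℕ → ℕ → Bool
rimSubClause n a b     = ((0 <ᵇ a) ∧ (a <ᵇ suc n)) ∧ (b ≡ᵇ a + n)
subNextRimClause n a b = ((n <ᵇ b) ∧ (b <ᵇ n + n)) ∧ (a ≡ᵇ suc (b ∸ n))

GearEdge⇒gearArc : ∀ {n a b} → GearEdge n a b → T (gearArc n a b)
GearEdge⇒gearArc (centre–rim i<n) = from T-∨ (inj₁ (<⇒<ᵇ i<n))
GearEdge⇒gearArc {n} (rim–sub {i} i<n) =
  from T-∨ (inj₁ (from T-∧ (<⇒<ᵇ i<n , ≡⇒≡ᵇ (suc i + n) (suc i + n) refl)))
GearEdge⇒gearArc {n} {a} {b} (sub–nextRim {i} 1+i<n) =
  from (T-∨ {rimSubClause n a b}) (inj₂ (from T-∨ (inj₁ (from T-∧ (from T-∧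
    (<⇒<ᵇ (m<n+m n z<s) , <⇒<ᵇ (+-monoˡ-< n 1+i<n)) ,
     ≡⇒≡ᵇ a (suc (b ∸ n)) (cong suc (sym (m+n∸n≡m (suc i) n))))))))
GearEdge⇒gearArc {n} {a} {b} (lastSub–firstRim {i} 1+i≡n) =
  from (T-∨ {rimSubClause n a b}) (inj₂ (from (T-∨ {subNextRimClause n a b}) (inj₂
    (from T-∧ (≡⇒≡ᵇ b (n + n) (cong (_+ n) 1+i≡n) , _)))))

≢⇒T-not-≡ᵇ : ∀ {a b} → a ≢ b → T (not (a ≡ᵇ b))
≢⇒T-not-≡ᵇ {a} {b} a≢b = from T-not-≡ (¬-not (a≢b ∘ ≡ᵇ⇒≡ a b ∘ from T-≡))

GearAdj : ℕ → ℕ → ℕ → Set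
GearAdj n a b = GearEdge n a b ⊎ GearEdge n b a

GearAdj⇒gearAdjSafe : ∀ {n a b} → GearAdj n a b → T (gearAdjSafe n a b)
GearAdj⇒gearAdjSafe {n} {a} {b} ab =
  from T-∧ (≢⇒T-not-≡ᵇ a≢b , from (T-∨ {gearArc n a b}) (⊎-map GearEdge⇒gearArc GearEdge⇒gearArc ab))
  where
  a≢b : a ≢ b
  a≢b = [ <⇒≢ ∘ GearEdge⇒< , >⇒≢ ∘ GearEdge⇒< ] ab

GearAdj⇒< : ∀ {n a b} → GearAdj n a b → b < suc (n + n)
GearAdj⇒< (inj₁ e) = s≤s (GearEdge⇒≤ e)
GearAdj⇒< (inj₂ e) = m<n⇒m<1+n (<-≤-trans (GearEdge⇒< e) (GearEdge⇒≤ e))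

gearLabel : ℕ → ℕ → ℕ
gearLabel n = zeroToLastℕ (n + n)

data GearCoprime (n k : ℕ) : Set where
  neighbour-labelled-1   : GearAdj n k 1 → GearCoprime n k
  consecutive-neighbours : ∀ {a b} → GearAdj n k a → GearAdj n k b →
                           gearLabel n b ≡ suc (gearLabel n a) → GearCoprime n k

data GearVertex (n : ℕ) : ℕ → Set where
  centre : GearVertex n 0
  rim    : ∀ {i} → i < n → GearVertex n (suc i)
  sub    : ∀ {i} → i < n → GearVertex n (suc i + n)

gearVertex : ∀ {n} k → k < suc (n + n) → GearVertex n k
gearVertex zero _ = centre
gearVertex {n} (suc m) (s≤s m<n+n) with m <? n
... | yes m<n = rim m<n
... | no  m≮n = subst (GearVertex n ∘ suc) m-n+n≡m (sub (+-cancelʳ-< n (m ∸ n) n m-n+n<n+n))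
  where
  m-n+n≡m : m ∸ n + n ≡ m
  m-n+n≡m = m∸n+n≡m (≮⇒≥ m≮n)
  m-n+n<n+n : m ∸ n + n < n + n
  m-n+n<n+n = subst (_< n + n) (sym m-n+n≡m) m<n+n

gearCoprime : ∀ {n k} → 0 < n → GearVertex n k → GearCoprime n k
gearCoprime 0<n centre = neighbour-labelled-1 (inj₁ (centre–rim 0<n))
gearCoprime _ (rim {zero} (s≤s z≤n)) =
  consecutive-neighbours (inj₁ (lastSub–firstRim refl)) (inj₂ (centre–rim z<s)) refl
gearCoprime _ (rim {suc j} 1+j<n) =
  consecutive-neighbours (inj₁ (sub–nextRim 1+j<n)) (inj₁ (rim–sub 1+j<n)) refl
gearCoprime _ (sub i<n) with m≤n⇒m<n∨m≡n i<n
... | inj₁ 1+i<n = consecutive-neighbours (inj₂ (rim–sub i<n)) (inj₂ (sub–nextRim 1+i<n)) refl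
... | inj₂ 1+i≡n = neighbour-labelled-1 (inj₂ (lastSub–firstRim 1+i≡n))

module _ {n} (v : Fin (suc (n + n))) where

  private
    neighbourAt : ∀ {a} → GearAdj n (toℕ v) a → Fin (suc (n + n))
    neighbourAt va = fromℕ< (GearAdj⇒< va)

    adj-neighbourAt : ∀ {a} (va : GearAdj n (toℕ v) a) → T (adj (gear n) v (neighbourAt va))
    adj-neighbourAt va =
      subst (T ∘ gearAdjSafe n (toℕ v)) (sym (toℕ-fromℕ< (GearAdj⇒< va))) (GearAdj⇒gearAdjSafe va)

    label-neighbourAt : ∀ {a} (va : GearAdj n (toℕ v) a) →
                        label (zeroToLast (n + n)) (neighbourAt va) ≡ gearLabel n a
    label-neighbourAt va =
      trans (label-zeroToLast (neighbourAt va)) (cong (gearLabel n) (toℕ-fromℕ< (GearAdj⇒< va)))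

  GearCoprime⇒CoprimeNeighbours :
    GearCoprime n (toℕ v) → CoprimeNeighbours (gear n) (zeroToLast (n + n)) v
  GearCoprime⇒CoprimeNeighbours (neighbour-labelled-1 v1) =
    neighbour-labelled-1 (adj-neighbourAt v1) (label-neighbourAt v1)
  GearCoprime⇒CoprimeNeighbours (consecutive-neighbours va vb b↦1+a) =
    consecutive-neighbours (adj-neighbourAt va) (adj-neighbourAt vb) (begin
      label (zeroToLast (n + n)) (neighbourAt vb)        ≡⟨ label-neighbourAt vb ⟩
      gearLabel n _                                      ≡⟨ b↦1+a ⟩
      suc (gearLabel n _)                                ≡⟨ cong suc (label-neighbourAt va) ⟨
      suc (label (zeroToLast (n + n)) (neighbourAt va))  ∎)
    where open ≡-Reasoning

mainTheorem1 : (n : ℕ) → 3 ≤ n → NeighborhoodPrime (gear n)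
mainTheorem1 n 3≤n = zeroToLast (n + n) , λ v _ →
  coprimeNeighbours⇒gcd≡1 (gear n) (zeroToLast (n + n))
    (GearCoprime⇒CoprimeNeighbours v (gearCoprime 0<n (gearVertex (toℕ v) (toℕ<n v))))
  where
  0<n : 0 < n
  0<n = ≤-trans (s≤s z≤n) 3≤n
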